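{- For every integer $n>1$, the centipede graph $P_n\circ K_1$ is a $G_\phi$-graph.
   Context: $\phi$ denotes Euler's totient function, $\phi^0(n)=n$ and $\phi^i(n)=\phi(\phi^{i-1}(n))$. For a set $A$ of positive integers, $A_\phi=\{\phi^k(n): n\in A,\ k\ge 0\}$, and $G_\phi(A)$ is the simple graph with vertex set $A_\phi$ in which distinct vertices $r,s$ are adjacent iff $\phi(r)=s$ or $\phi(s)=r$. A graph $H$ is a $G_\phi$-graph if there exists a set $A$ of positive integers such that $H$ is (isomorphic to) $G_\phi(A)$. $P_n\circ K_1$ is the graph obtained from the path $P_n$ on $n$ vertices by attaching, to each vertex $v$ of the path, a new vertex $v'$ via a pendant edge $vv'$. -}

module Defs where

open import Level using (0ℓ)
open import Data.Nat using (ℕ; zero; suc; _<_; _≟_)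
open import Data.Nat.GCD using (gcd)
open import Data.List using (length; filter; upTo)
open import Data.Fin using (Fin; toℕ)
open import Data.Bool using (Bool; true; false)
open import Data.Product using (Σ; ∃; _×_; _,_)
open import Data.Sum using (_⊎_)
open import Data.Empty using (⊥)
open import Relation.Binary.PropositionalEquality using (_≡_; _≢_)
open import Function.Bundles using (_⇔_)

φ : ℕ → ℕ
φ n = length (filter (λ k → gcd (suc k) n ≟ 1) (upTo n))

φ^ : ℕ → ℕ → ℕ
φ^ zero n = n
φ^ (suc i) n = φ (φ^ i n)

Aφ : (ℕ → Set) → ℕ → Set
Aφ A m = ∃ λ n → ∃ λ k → A n × φ^ k n ≡ m

GφAdj : ℕ → ℕ → Set
GφAdj r s = r ≢ s × (φ r ≡ s ⊎ φ s ≡ r)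

IsoToGφ : (V : Set) → (V → V → Set) → (ℕ → Set) → Set
IsoToGφ V Adj A =
  Σ (V → ℕ) λ f →
    (∀ u v → f u ≡ f v → u ≡ v) ×
    (∀ u → Aφ A (f u)) ×
    (∀ m → Aφ A m → ∃ λ u → f u ≡ m) ×
    (∀ u v → Adj u v ⇔ GφAdj (f u) (f v))

IsGφGraph : (V : Set) → (V → V → Set) → Set₁
IsGφGraph V Adj = Σ (ℕ → Set) λ A → (∀ n → A n → 0 < n) × IsoToGφ V Adj A

-- centipede P_n ∘ K₁: vertices (i , false) = path vertex i, (i , true) = its pendant vertex i'
CentipedeAdj : (n : ℕ) → Fin n × Bool → Fin n × Bool → Set
CentipedeAdj n (i , false) (j , false) = toℕ j ≡ suc (toℕ i) ⊎ toℕ i ≡ suc (toℕ j)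
CentipedeAdj n (i , false) (j , true) = i ≡ j
CentipedeAdj n (i , true) (j , false) = i ≡ j
CentipedeAdj n (i , true) (j , true) = ⊥

-- Label the path vertices by 2, 4, …, 2ⁿ, the pendant of the first one by 1 and the pendant of
-- the i-th one (i ≥ 2) by 3·2ⁱ. Since φ(2ᵏ⁺¹) = 2ᵏ and φ(3·2ᵏ⁺¹) = 2ᵏ⁺¹, the labels are closed
-- under φ and φ maps every label to the label of its neighbour towards the first path vertex
-- (and 1 to itself), so taking A to be the set of labels, G_φ(A) is exactly the centipede.
module Submission where

open import Defs
open import Data.Nat
open import Data.Nat.Properties
open import Data.Nat.GCD using (gcd)
open import Data.Nat.Divisibility
open import Data.Nat.Coprimality using (Coprime; coprime⇒gcd≡1; gcd≡1⇒coprime; coprime-+; coprime-divisor)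
open import Data.Nat.Primality using (Prime; prime?; euclidsLemma)
open import Data.Fin using (Fin; toℕ; inject₁) renaming (zero to fzero; suc to fsuc)
open import Data.Fin.Properties using (toℕ-injective; toℕ-inject₁)
open import Data.Bool using (Bool; true; false)
open import Data.List using (_∷_; _++_; length; filter; applyUpTo; upTo)
open import Data.List.Properties using (length-++; filter-++; filter-≐)
open import Data.Product using (∃; _×_; _,_)
open import Data.Sum using (_⊎_; inj₁; inj₂)
open import Level using (Level)
open import Function using (_∘_; id)
open import Function.Bundles using (_⇔_; mk⇔; Equivalence)
open import Function.Construct.Composition using (_⇔-∘_)
open import Function.Construct.Symmetry using (⇔-sym)
open import Relation.Nullary using (¬_; yes; no; contradiction)
open import Relation.Binary.Definitions using (tri<; tri≈; tri>)
open import Relation.Nullary.Decidable using (toWitness)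
open import Relation.Unary using (Pred; Decidable)
open import Relation.Binary.PropositionalEquality

private
  variable
    a p : Level
    A : Set a

applyUpTo-+ : ∀ (f : ℕ → A) m n → applyUpTo f (m + n) ≡ applyUpTo f m ++ applyUpTo (f ∘ (m +_)) n
applyUpTo-+ f zero    n = refl
applyUpTo-+ f (suc m) n = cong (f 0 ∷_) (applyUpTo-+ (f ∘ suc) m n)

module _ {P : Pred ℕ p} (P? : Decidable P) where

  count : ℕ → ℕ
  count n = length (filter P? (upTo n))

  length-filter-applyUpTo-cong : ∀ {f g : ℕ → ℕ} → (∀ k → P (f k) ⇔ P (g k)) →
                                 ∀ n → length (filter P? (applyUpTo f n)) ≡ length (filter P? (applyUpTo g n))
  length-filter-applyUpTo-cong         P∘f⇔P∘g zero    = refl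
  length-filter-applyUpTo-cong {f} {g} P∘f⇔P∘g (suc n) with P? (f 0) | P? (g 0)
  ... | yes _    | yes _    = cong suc (length-filter-applyUpTo-cong (P∘f⇔P∘g ∘ suc) n)
  ... | no  _    | no  _    = length-filter-applyUpTo-cong (P∘f⇔P∘g ∘ suc) n
  ... | yes Pf0  | no  ¬Pg0 = contradiction (Equivalence.to (P∘f⇔P∘g 0) Pf0) ¬Pg0
  ... | no  ¬Pf0 | yes Pg0  = contradiction (Equivalence.from (P∘f⇔P∘g 0) Pg0) ¬Pf0

  count-periodic : ∀ {N} → (∀ k → P (N + k) ⇔ P k) → ∀ q → count (q * N) ≡ q * count N
  count-periodic {N} periodic zero    = refl
  count-periodic {N} periodic (suc q) = begin
    length (filter P? (upTo (N + q * N)))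
      ≡⟨ cong (length ∘ filter P?) (applyUpTo-+ id N (q * N)) ⟩
    length (filter P? (upTo N ++ applyUpTo (N +_) (q * N)))
      ≡⟨ cong length (filter-++ P? (upTo N) _) ⟩
    length (filter P? (upTo N) ++ filter P? (applyUpTo (N +_) (q * N)))
      ≡⟨ length-++ (filter P? (upTo N)) ⟩
    count N + length (filter P? (applyUpTo (N +_) (q * N)))
      ≡⟨ cong (count N +_) (length-filter-applyUpTo-cong periodic (q * N)) ⟩
    count N + count (q * N)
      ≡⟨ cong (count N +_) (count-periodic periodic q) ⟩
    count N + q * count N ∎
    where open ≡-Reasoning

coprime-+⇔ : ∀ {m n} → Coprime (n + m) n ⇔ Coprime m n
coprime-+⇔ = mk⇔ (λ c {_} (d∣m , d∣n) → c (∣m∣n⇒∣m+n d∣n d∣m , d∣n)) coprime-+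

coprime-*ˡ⇔ : ∀ {k m n} → k ∣ n → Coprime m (k * n) ⇔ Coprime m n
coprime-*ˡ⇔ {k} {m} {n} k∣n = mk⇔
  (λ c {_} (d∣m , d∣n) → c (d∣m , ∣n⇒∣m*n k d∣n))
  (λ c {d} (d∣m , d∣kn) → c (d∣m , coprime-divisor (coprime-with-k c d∣m) d∣kn))
  where
    coprime-with-k : Coprime m n → ∀ {d} → d ∣ m → Coprime d k
    coprime-with-k c d∣m {_} (e∣d , e∣k) = c (∣-trans e∣d d∣m , ∣-trans e∣k k∣n)

gcd≡1⇔ : ∀ {m n m′ n′} → Coprime m n ⇔ Coprime m′ n′ → (gcd m n ≡ 1) ⇔ (gcd m′ n′ ≡ 1)
gcd≡1⇔ e = mk⇔ (coprime⇒gcd≡1 ∘ Equivalence.to e ∘ gcd≡1⇒coprime)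
               (coprime⇒gcd≡1 ∘ Equivalence.from e ∘ gcd≡1⇒coprime)

-- Coprimality to kN and to N agree, and the totatives of N are N-periodic.
φ-*-of-∣ : ∀ {k N} → k ∣ N → φ (k * N) ≡ k * φ N
φ-*-of-∣ {k} {N} k∣N = begin
  φ (k * N)
    ≡⟨ cong length (filter-≐ _ _ (Equivalence.to same-totatives , Equivalence.from same-totatives) (upTo (k * N))) ⟩
  count (λ j → gcd (suc j) N ≟ 1) (k * N)
    ≡⟨ count-periodic (λ j → gcd (suc j) N ≟ 1) periodic k ⟩
  k * φ N ∎
  where
    open ≡-Reasoning
    same-totatives : ∀ {j} → (gcd (suc j) (k * N) ≡ 1) ⇔ (gcd (suc j) N ≡ 1)
    same-totatives {j} = gcd≡1⇔ {suc j} {k * N} (coprime-*ˡ⇔ k∣N)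
    periodic : ∀ j → (gcd (suc (N + j)) N ≡ 1) ⇔ (gcd (suc j) N ≡ 1)
    periodic j rewrite sym (+-suc N j) = gcd≡1⇔ {N + suc j} {N} coprime-+⇔

φ-2^suc : ∀ k → φ (2 ^ suc k) ≡ 2 ^ k
φ-2^suc zero    = refl
φ-2^suc (suc k) = begin
  φ (2 * 2 ^ suc k)   ≡⟨ φ-*-of-∣ {2} {2 ^ suc k} (m∣m*n (2 ^ k)) ⟩
  2 * φ (2 ^ suc k)   ≡⟨ cong (2 *_) (φ-2^suc k) ⟩
  2 * 2 ^ k           ∎
  where open ≡-Reasoning

φ-3*2^suc : ∀ k → φ (3 * 2 ^ suc k) ≡ 2 ^ suc k
φ-3*2^suc zero    = refl
φ-3*2^suc (suc k) = begin
  φ (3 * (2 * 2 ^ suc k))   ≡⟨ cong φ (*-swap 3 2 (2 ^ suc k)) ⟩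
  φ (2 * (3 * 2 ^ suc k))   ≡⟨ φ-*-of-∣ {2} {3 * 2 ^ suc k} (∣n⇒∣m*n 3 (m∣m*n (2 ^ k))) ⟩
  2 * φ (3 * 2 ^ suc k)     ≡⟨ cong (2 *_) (φ-3*2^suc k) ⟩
  2 * 2 ^ suc k             ∎
  where
    open ≡-Reasoning
    *-swap : ∀ x y z → x * (y * z) ≡ y * (x * z)
    *-swap x y z = trans (sym (*-assoc x y z)) (trans (cong (_* z) (*-comm x y)) (*-assoc y x z))

2^-injective : ∀ m n → 2 ^ m ≡ 2 ^ n → m ≡ n
2^-injective m n eq with <-cmp m n
... | tri< m<n _ _ = contradiction eq (<⇒≢ (^-monoʳ-< 2 (s≤s (s≤s z≤n)) m<n))
... | tri≈ _ m≡n _ = m≡n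
... | tri> _ _ n<m = contradiction (sym eq) (<⇒≢ (^-monoʳ-< 2 (s≤s (s≤s z≤n)) n<m))

prime[3] : Prime 3
prime[3] = toWitness {a? = prime? 3} _

3∤2^ : ∀ k → ¬ 3 ∣ 2 ^ k
3∤2^ zero    3∣1 = contradiction (∣1⇒≡1 3∣1) λ ()
3∤2^ (suc k) 3∣2^suc with euclidsLemma 2 (2 ^ k) prime[3] 3∣2^suc
... | inj₁ 3∣2 = contradiction (∣⇒≤ 3∣2) λ { (s≤s (s≤s ())) }
... | inj₂ 3∣2^k = 3∤2^ k 3∣2^k

2^≢3*2^ : ∀ m n → 2 ^ m ≢ 3 * 2 ^ n
2^≢3*2^ m n eq = 3∤2^ m (subst (3 ∣_) (sym eq) (m∣m*n (2 ^ n)))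

ParentAdj : {V : Set} → (V → V) → V → V → Set
ParentAdj parent u v = u ≢ v × (parent u ≡ v ⊎ parent v ≡ u)

module φLabelling {V : Set} (label : V → ℕ) (parent : V → V)
                  (label-injective : ∀ u v → label u ≡ label v → u ≡ v)
                  (φ-label : ∀ u → φ (label u) ≡ label (parent u)) where

  φ^-label : ∀ k u → ∃ λ v → label v ≡ φ^ k (label u)
  φ^-label zero    u = u , refl
  φ^-label (suc k) u with v , label-v ← φ^-label k u = parent v , trans (sym (φ-label v)) (cong φ label-v)

  GφAdj-label⇔ParentAdj : ∀ u v → GφAdj (label u) (label v) ⇔ ParentAdj parent u v
  GφAdj-label⇔ParentAdj u v = mk⇔ to from
    where
      to : GφAdj (label u) (label v) → ParentAdj parent u v
      to (lu≢lv , inj₁ φlu≡lv) = lu≢lv ∘ cong label , inj₁ (label-injective _ _ (trans (sym (φ-label u)) φlu≡lv))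
      to (lu≢lv , inj₂ φlv≡lu) = lu≢lv ∘ cong label , inj₂ (label-injective _ _ (trans (sym (φ-label v)) φlv≡lu))
      from : ParentAdj parent u v → GφAdj (label u) (label v)
      from (u≢v , inj₁ pu≡v) = u≢v ∘ label-injective _ _ , inj₁ (trans (φ-label u) (cong label pu≡v))
      from (u≢v , inj₂ pv≡u) = u≢v ∘ label-injective _ _ , inj₂ (trans (φ-label v) (cong label pv≡u))

  isGφGraph : ∀ {Adj : V → V → Set} → (∀ u → 0 < label u) →
              (∀ u v → Adj u v ⇔ ParentAdj parent u v) → IsGφGraph V Adj
  isGφGraph label-positive adj⇔ =
    Labels , (λ { _ (u , refl) → label-positive u }) ,
    label , label-injective ,
    (λ u → label u , 0 , (u , refl) , refl) ,
    (λ { _ (_ , k , (u , refl) , refl) → φ^-label k u }) ,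
    (λ u v → ⇔-sym (GφAdj-label⇔ParentAdj u v) ⇔-∘ adj⇔ u v)
    where
      Labels : ℕ → Set
      Labels x = ∃ λ u → label u ≡ x

module Centipede {n : ℕ} where

  label : Fin n × Bool → ℕ
  label (i       , false) = 2 ^ suc (toℕ i)
  label (fzero   , true)  = 1
  label (fsuc i  , true)  = 3 * 2 ^ suc (toℕ (fsuc i))

  parent : Fin n × Bool → Fin n × Bool
  parent (fzero  , false) = fzero , true
  parent (fsuc i , false) = inject₁ i , false
  parent (fzero  , true)  = fzero , true
  parent (fsuc i , true)  = fsuc i , false

  φ-label : ∀ u → φ (label u) ≡ label (parent u)
  φ-label (fzero  , false) = refl
  φ-label (fsuc i , false) rewrite toℕ-inject₁ i = φ-2^suc (suc (toℕ i))
  φ-label (fzero  , true)  = refl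
  φ-label (fsuc i , true)  = φ-3*2^suc (suc (toℕ i))

  label-positive : ∀ u → 0 < label u
  label-positive (i      , false) = m^n>0 2 (suc (toℕ i))
  label-positive (fzero  , true)  = z<s
  label-positive (fsuc i , true)  = *-monoʳ-< 3 (m^n>0 2 (suc (suc (toℕ i))))

  label-injective : ∀ u v → label u ≡ label v → u ≡ v
  label-injective (i      , false) (j      , false) eq =
    cong (_, false) (toℕ-injective (suc-injective (2^-injective (suc (toℕ i)) (suc (toℕ j)) eq)))
  label-injective (i      , false) (fzero  , true)  eq = contradiction (2^-injective (suc (toℕ i)) 0 eq) λ ()
  label-injective (i      , false) (fsuc j , true)  eq = contradiction eq (2^≢3*2^ (suc (toℕ i)) (2 + toℕ j))
  label-injective (fzero  , true)  (j      , false) eq = contradiction (2^-injective 0 (suc (toℕ j)) eq) λ ()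
  label-injective (fzero  , true)  (fzero  , true)  eq = refl
  label-injective (fzero  , true)  (fsuc j , true)  eq = contradiction eq (2^≢3*2^ 0 (2 + toℕ j))
  label-injective (fsuc i , true)  (j      , false) eq = contradiction (sym eq) (2^≢3*2^ (suc (toℕ j)) (2 + toℕ i))
  label-injective (fsuc i , true)  (fzero  , true)  eq = contradiction (sym eq) (2^≢3*2^ 0 (2 + toℕ i))
  label-injective (fsuc i , true)  (fsuc j , true)  eq =
    cong (_, true) (toℕ-injective (suc-injective
      (2^-injective (2 + toℕ i) (2 + toℕ j) (*-cancelˡ-≡ (2 ^ (2 + toℕ i)) (2 ^ (2 + toℕ j)) 3 eq))))

  CentipedeAdj-sym : ∀ {u v} → CentipedeAdj n u v → CentipedeAdj n v u
  CentipedeAdj-sym {_ , false} {_ , false} (inj₁ j≡1+i) = inj₂ j≡1+i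
  CentipedeAdj-sym {_ , false} {_ , false} (inj₂ i≡1+j) = inj₁ i≡1+j
  CentipedeAdj-sym {_ , false} {_ , true}  i≡j          = sym i≡j
  CentipedeAdj-sym {_ , true}  {_ , false} i≡j          = sym i≡j

  CentipedeAdj⇒≢ : ∀ {u v} → CentipedeAdj n u v → u ≢ v
  CentipedeAdj⇒≢ {i , false} {_ , false} (inj₁ i≡1+i) refl = 1+n≢n (sym i≡1+i)
  CentipedeAdj⇒≢ {i , false} {_ , false} (inj₂ i≡1+i) refl = 1+n≢n (sym i≡1+i)
  CentipedeAdj⇒≢ {_ , false} {_ , true}  _ ()
  CentipedeAdj⇒≢ {_ , true}  {_ , false} _ ()

  parent-of-successor : ∀ {i j : Fin n} → toℕ j ≡ suc (toℕ i) → parent (j , false) ≡ (i , false)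
  parent-of-successor {j = fsuc j} j≡1+i =
    cong (_, false) (toℕ-injective (trans (toℕ-inject₁ j) (suc-injective j≡1+i)))

  CentipedeAdj⇒parent : ∀ {u v} → CentipedeAdj n u v → parent u ≡ v ⊎ parent v ≡ u
  CentipedeAdj⇒parent {_      , false} {_ , false} (inj₁ j≡1+i) = inj₂ (parent-of-successor j≡1+i)
  CentipedeAdj⇒parent {_      , false} {_ , false} (inj₂ i≡1+j) = inj₁ (parent-of-successor i≡1+j)
  CentipedeAdj⇒parent {fzero  , false} {_ , true}  refl = inj₁ refl
  CentipedeAdj⇒parent {fsuc _ , false} {_ , true}  refl = inj₂ refl
  CentipedeAdj⇒parent {fzero  , true}  {_ , false} refl = inj₂ refl
  CentipedeAdj⇒parent {fsuc _ , true}  {_ , false} refl = inj₁ refl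

  CentipedeAdj-parent : ∀ u → u ≢ parent u → CentipedeAdj n u (parent u)
  CentipedeAdj-parent (fzero  , false) _ = refl
  CentipedeAdj-parent (fsuc i , false) _ = inj₂ (cong suc (sym (toℕ-inject₁ i)))
  CentipedeAdj-parent (fzero  , true)  u≢u = contradiction refl u≢u
  CentipedeAdj-parent (fsuc i , true)  _ = refl

  CentipedeAdj⇔ParentAdj : ∀ u v → CentipedeAdj n u v ⇔ ParentAdj parent u v
  CentipedeAdj⇔ParentAdj u v = mk⇔ (λ adj → CentipedeAdj⇒≢ adj , CentipedeAdj⇒parent adj) from
    where
      from : ParentAdj parent u v → CentipedeAdj n u v
      from (u≢v , inj₁ refl) = CentipedeAdj-parent u u≢v
      from (u≢v , inj₂ refl) = CentipedeAdj-sym (CentipedeAdj-parent v (u≢v ∘ sym))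

  isGφGraph : IsGφGraph (Fin n × Bool) (CentipedeAdj n)
  isGφGraph = φLabelling.isGφGraph label parent label-injective φ-label label-positive CentipedeAdj⇔ParentAdj

-- The construction works for every n.
theorem2p12 : (n : ℕ) → 1 < n → IsGφGraph (Fin n × Bool) (CentipedeAdj n)
theorem2p12 n _ = Centipede.isGφGraph
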